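{- Let $\mathcal{L}$ be a classical propositional language, and let $\mathcal{A}=\{A_1,\dots,A_n\}$ be a partition of $M_{\mathcal{L}}$ into nonempty sets ordered $A_1<\dots<A_n$, with $A_i=M(\alpha_i)$ for formulas $\alpha_i$. (a) If $\mu:\mathbf{D}_{\mathcal{L}}\to\mathcal{P}(M_{\mathcal{L}})$ satisfies $(\mu dp)$, $(\mu\subseteq)$, $(\mu PR)$, then the logic $\hspace{0.2em}\sim\hspace{ -0.9em}\mid\hspace{0.58em}$ defined by $\overline{\overline{T}}:=Th(\mu(M(T)))$ satisfies (LLE), (CCL), (SC), (PR). If $\mu$ satisfies in addition $(\mu CUM)$, then (CUM) holds too. If $\mu$ satisfies in addition $(\mu\mathcal{A})$, then $(\mathcal{A}\text{ -min})$ holds too. (b) If a logic $\hspace{0.2em}\sim\hspace{ -0.9em}\mid\hspace{0.58em}$ satisfies (LLE), (CCL), (SC), (PR), then there is $\mu:\mathbf{D}_{\mathcal{L}}\to\mathcal{P}(M_{\mathcal{L}})$ such that $\overline{\overline{T}}=Th(\mu(M(T)))$ for all $T\subseteq\mathcal{L}$ and $\mu$ satisfies $(\mu dp)$, $(\mu\subseteq)$, $(\mu PR)$. If, in addition, (CUM) holds, then $(\mu CUM)$ holds too. If, in addition, $(\mathcal{A}\text{ -min})$ holds, then $(\mu\mathcal{A})$ holds too.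
   Context: $M_{\mathcal{L}}$: classical models of $\mathcal{L}$; $M(T)$: models of theory $T$; $\mathbf{D}_{\mathcal{L}}:=\{M(T):T\subseteq\mathcal{L}\}$; $Th(X):=\{\phi:X\models\phi\}$; $\vdash$ classical derivability; $\overline{T}:=\{\phi:T\vdash\phi\}$; a logic is a relation $\hspace{0.2em}\sim\hspace{ -0.9em}\mid\hspace{0.58em}$ between theories and formulas with $\overline{\overline{T}}:=\{\phi:T\hspace{0.2em}\sim\hspace{ -0.9em}\mid\hspace{0.58em}\phi\}$. Logical conditions (for all theories $T,T'$): (LLE) $\overline{T}=\overline{T'}\Rightarrow\overline{\overline{T}}=\overline{\overline{T'}}$; (CCL) $\overline{\overline{T}}$ classically closed; (SC) $\overline{T}\subseteq\overline{\overline{T}}$; (PR) $\overline{\overline{T\cup T'}}\subseteq\overline{\overline{\overline{T}}\cup T'}$; (CUM) $T\subseteq\overline{T'}\subseteq\overline{\overline{T}}\Rightarrow\overline{\overline{T}}=\overline{\overline{T'}}$; $(\mathcal{A}\text{ -min})$ for $i<j$, $T\not\vdash\neg\alpha_i$ and $T\not\vdash\neg\alpha_j$ imply $\overline{\overline{T}}\vdash\neg\alpha_j$. Conditions on $\mu$ (for all $X,Y\in\mathbf{D}_{\mathcal{L}}$): $(\mu dp)$ $\mu(X)\in\mathbf{D}_{\mathcal{L}}$; $(\mu\subseteq)$ $\mu(X)\subseteq X$; $(\mu PR)$ $X\subseteq Y\Rightarrow\mu(Y)\cap X\subseteq\mu(X)$; $(\mu CUM)$ $\mu(X)\subseteq Y\subseteq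 X\Rightarrow\mu(Y)=\mu(X)$; $(\mu\mathcal{A})$ if $A,A'\in\mathcal{A}$, $A<A'$, $X\cap A\neq\emptyset$, $X\cap A'\neq\emptyset$, then $\mu(X)\cap A'=\emptyset$. -}

module Defs where

open import Data.Bool using (Bool; true; false; not; _∧_; _∨_)
open import Data.Nat using (ℕ)
open import Data.Fin using (Fin; _<_)
open import Data.Product using (Σ; _×_; ∃)
open import Data.Sum using (_⊎_)
open import Data.Empty using (⊥)
open import Relation.Nullary using (¬_)
open import Relation.Binary.PropositionalEquality using (_≡_)

data Form (V : Set) : Set where
  var  : V → Form V
  fls  : Form V
  tru  : Form V
  neg  : Form V → Form V
  and  : Form V → Form V → Form V
  or   : Form V → Form V → Form V
  imp  : Form V → Form V → Form V

Model : Set → Set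
Model V = V → Bool

eval : {V : Set} → Model V → Form V → Bool
eval v (var x)   = v x
eval v fls       = false
eval v tru       = true
eval v (neg φ)   = not (eval v φ)
eval v (and φ ψ) = eval v φ ∧ eval v ψ
eval v (or φ ψ)  = eval v φ ∨ eval v ψ
eval v (imp φ ψ) = not (eval v φ) ∨ eval v ψ

_⊨_ : {V : Set} → Model V → Form V → Set
v ⊨ φ = eval v φ ≡ true

Theory : Set → Set₁
Theory V = Form V → Set

ModelSet : Set → Set₁
ModelSet V = Model V → Set

_⊆ᵀ_ : {V : Set} → Theory V → Theory V → Set
T ⊆ᵀ T' = ∀ φ → T φ → T' φ

_≐ᵀ_ : {V : Set} → Theory V → Theory V → Set
T ≐ᵀ T' = (T ⊆ᵀ T') × (T' ⊆ᵀ T)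

_∪ᵀ_ : {V : Set} → Theory V → Theory V → Theory V
(T ∪ᵀ T') φ = T φ ⊎ T' φ

_⊆ᴹ_ : {V : Set} → ModelSet V → ModelSet V → Set
X ⊆ᴹ Y = ∀ v → X v → Y v

_≐ᴹ_ : {V : Set} → ModelSet V → ModelSet V → Set
X ≐ᴹ Y = (X ⊆ᴹ Y) × (Y ⊆ᴹ X)

_∩ᴹ_ : {V : Set} → ModelSet V → ModelSet V → ModelSet V
(X ∩ᴹ Y) v = X v × Y v

Mod : {V : Set} → Theory V → ModelSet V
Mod T v = ∀ φ → T φ → v ⊨ φ

Th : {V : Set} → ModelSet V → Theory V
Th X φ = ∀ v → X v → v ⊨ φ

-- Classical consequence T ⊢ φ (semantic, equivalent to derivability by
-- soundness and completeness), and classical closure \overline{T}.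
_⊢_ : {V : Set} → Theory V → Form V → Set
T ⊢ φ = ∀ v → Mod T v → v ⊨ φ

Cl : {V : Set} → Theory V → Theory V
Cl T φ = T ⊢ φ

Definable : {V : Set} → ModelSet V → Set₁
Definable {V} X = Σ (Theory V) (λ T → X ≐ᴹ Mod T)

-- A logic, given as T ↦ \overline{\overline{T}} = {φ : T |~ φ}.
Logic : Set → Set₁
Logic V = Theory V → Theory V

IsOrderedPartition : {V : Set} {n : ℕ} → (Fin n → Form V) → Set
IsOrderedPartition {V} {n} α =
  (∀ i → ∃ λ (v : Model V) → v ⊨ α i)
  × (∀ i j → ∀ (v : Model V) → v ⊨ α i → v ⊨ α j → i ≡ j)
  × (∀ (v : Model V) → ∃ λ i → v ⊨ α i)

module _ {V : Set} where

  LLE : Logic V → Set₁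
  LLE C = ∀ T T' → Cl T ≐ᵀ Cl T' → C T ≐ᵀ C T'

  CCL : Logic V → Set₁
  CCL C = ∀ T → Cl (C T) ⊆ᵀ C T

  SC : Logic V → Set₁
  SC C = ∀ T → Cl T ⊆ᵀ C T

  PR : Logic V → Set₁
  PR C = ∀ T T' → C (T ∪ᵀ T') ⊆ᵀ Cl (C T ∪ᵀ T')

  CUM : Logic V → Set₁
  CUM C = ∀ T T' → T ⊆ᵀ Cl T' → Cl T' ⊆ᵀ C T → C T ≐ᵀ C T'

  A-min : {n : ℕ} → (Fin n → Form V) → Logic V → Set₁
  A-min α C = ∀ T i j → i < j → ¬ (T ⊢ neg (α i)) → ¬ (T ⊢ neg (α j))
              → C T ⊢ neg (α j)

  μdp : (ModelSet V → ModelSet V) → Set₁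
  μdp μ = ∀ X → Definable X → Definable (μ X)

  μ⊆ : (ModelSet V → ModelSet V) → Set₁
  μ⊆ μ = ∀ X → Definable X → μ X ⊆ᴹ X

  μPR : (ModelSet V → ModelSet V) → Set₁
  μPR μ = ∀ X Y → Definable X → Definable Y → X ⊆ᴹ Y → (μ Y ∩ᴹ X) ⊆ᴹ μ X

  μCUM : (ModelSet V → ModelSet V) → Set₁
  μCUM μ = ∀ X Y → Definable X → Definable Y → μ X ⊆ᴹ Y → Y ⊆ᴹ X → μ Y ≐ᴹ μ X

  μA : {n : ℕ} → (Fin n → Form V) → (ModelSet V → ModelSet V) → Set₁
  μA α μ = ∀ X → Definable X → ∀ i j → i < j
           → (∃ λ v → X v × v ⊨ α i) → (∃ λ v → X v × v ⊨ α j)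
           → ∀ v → μ X v → ¬ (v ⊨ α j)

  logicOf : (ModelSet V → ModelSet V) → Logic V
  logicOf μ T = Th (μ (Mod T))

{-# OPTIONS --safe #-}
-- M and Th form an antitone Galois connection between theories and sets of
-- models, whose closed theories are the classically closed ones and whose
-- closed model sets are the definable ones.  Hence a logic and a choice
-- function μ on definable sets determine each other through
-- C T = Th (μ (M T)) and μ X = M (C (Th X)), and each condition on one side
-- is the image of the corresponding condition on the other.
module Submission where

open import Defs
open import Data.Nat using (ℕ)
open import Data.Fin using (Fin)
open import Data.Product using (Σ; ∃; _×_; _,_; proj₁; proj₂; swap)
open import Data.Sum using (inj₁; inj₂)
open import Data.Bool.Properties using (not-¬; ¬-not)
open import Relation.Nullary using (¬_)
open import Relation.Binary.PropositionalEquality using (sym)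

private
  variable
    V : Set
    X Y : ModelSet V
    T T' : Theory V
    φ : Form V
    v : Model V

⊨neg⇒⊭ : ∀ φ → v ⊨ neg φ → ¬ v ⊨ φ
⊨neg⇒⊭ _ ⊨¬φ ⊨φ = not-¬ (sym ⊨φ) (sym ⊨¬φ)

⊭⇒⊨neg : ∀ φ → ¬ v ⊨ φ → v ⊨ neg φ
⊭⇒⊨neg _ ⊭φ = sym (¬-not λ ⊨φ → ⊭φ (sym ⊨φ))

Meets : ModelSet V → Form V → Set
Meets X φ = ∃ λ v → X v × v ⊨ φ

Mod-Definable : Definable (Mod T)
Mod-Definable {T = T} = T , (λ _ m → m) , (λ _ m → m)

⊆-Cl : T ⊆ᵀ Cl T
⊆-Cl φ t v m = m φ t

⊆-Mod-Th : X ⊆ᴹ Mod (Th X)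
⊆-Mod-Th v x φ t = t v x

Definable⇒Mod-Th-⊆ : Definable X → Mod (Th X) ⊆ᴹ X
Definable⇒Mod-Th-⊆ (T , X⊆MT , MT⊆X) v m =
  MT⊆X v (λ φ t → m φ (λ w x → X⊆MT w x φ t))

Mod-antitone : T ⊆ᵀ T' → Mod T' ⊆ᴹ Mod T
Mod-antitone T⊆T' v m φ t = m φ (T⊆T' φ t)

Th-antitone : X ⊆ᴹ Y → Th Y ⊆ᵀ Th X
Th-antitone X⊆Y φ t v x = t v (X⊆Y v x)

Mod-cong : T ≐ᵀ T' → Mod T ≐ᴹ Mod T'
Mod-cong (T⊆T' , T'⊆T) = Mod-antitone T'⊆T , Mod-antitone T⊆T'

Th-cong : X ≐ᴹ Y → Th X ≐ᵀ Th Y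
Th-cong (X⊆Y , Y⊆X) = Th-antitone Y⊆X , Th-antitone X⊆Y

Mod-Cl : Mod T ⊆ᴹ Mod (Cl T)
Mod-Cl v m φ c = c v m

Cl-least : T ⊆ᵀ Cl T' → Cl T ⊆ᵀ Cl T'
Cl-least T⊆ClT' φ c v m = c v (λ ψ t → T⊆ClT' ψ t v m)

Cl-Th-⊆ : Cl (Th X) ⊆ᵀ Th X
Cl-Th-⊆ φ c v x = c v (⊆-Mod-Th v x)

Cl-idempotent : Cl (Cl T) ≐ᵀ Cl T
Cl-idempotent = Cl-least (λ _ c → c) , ⊆-Cl

⊆-Cl⇒Mod-⊇ : T ⊆ᵀ Cl T' → Mod T' ⊆ᴹ Mod T
⊆-Cl⇒Mod-⊇ T⊆ClT' v m = Mod-antitone T⊆ClT' v (Mod-Cl v m)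

Cl-≐⇒Mod-≐ : Cl T ≐ᵀ Cl T' → Mod T ≐ᴹ Mod T'
Cl-≐⇒Mod-≐ (ClT⊆ClT' , ClT'⊆ClT) =
  ⊆-Cl⇒Mod-⊇ (λ φ t → ClT'⊆ClT φ (⊆-Cl φ t)) ,
  ⊆-Cl⇒Mod-⊇ (λ φ t → ClT⊆ClT' φ (⊆-Cl φ t))

Mod-∪ : Mod T v → Mod T' v → Mod (T ∪ᵀ T') v
Mod-∪ m m' φ (inj₁ t) = m φ t
Mod-∪ m m' φ (inj₂ t) = m' φ t

Cl-∪-absorbˡ : T ⊆ᵀ Cl T' → Cl (T ∪ᵀ T') ≐ᵀ Cl T'
Cl-∪-absorbˡ T⊆ClT' =
  (λ φ c v m → c v (Mod-∪ (⊆-Cl⇒Mod-⊇ T⊆ClT' v m) m)) ,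
  (λ φ c v m → c v (Mod-antitone (λ _ → inj₂) v m))

Meets⇒Th-⊬neg : Meets X φ → ¬ Th X ⊢ neg φ
Meets⇒Th-⊬neg {φ = φ} (v , x , ⊨φ) ⊢¬φ = ⊨neg⇒⊭ φ (⊢¬φ v (⊆-Mod-Th v x)) ⊨φ

⊬neg⇒¬¬Meets-Mod : ¬ T ⊢ neg φ → ¬ ¬ Meets (Mod T) φ
⊬neg⇒¬¬Meets-Mod {φ = φ} ⊬¬φ ¬meets =
  ⊬¬φ (λ v m → ⊭⇒⊨neg φ (λ ⊨φ → ¬meets (v , m , ⊨φ)))

module _ (μ : ModelSet V → ModelSet V) where

  μ-cong : μ⊆ μ → μPR μ → Definable X → Definable Y → X ≐ᴹ Y → μ X ≐ᴹ μ Y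
  μ-cong sub pr dX dY (X⊆Y , Y⊆X) =
    (λ v m → pr _ _ dY dX Y⊆X v (m , X⊆Y v (sub _ dX v m))) ,
    (λ v m → pr _ _ dX dY X⊆Y v (m , Y⊆X v (sub _ dY v m)))

  logicOf-LLE : μ⊆ μ → μPR μ → LLE (logicOf μ)
  logicOf-LLE sub pr T T' ClT≐ClT' =
    Th-cong (μ-cong sub pr Mod-Definable Mod-Definable (Cl-≐⇒Mod-≐ ClT≐ClT'))

  logicOf-CCL : CCL (logicOf μ)
  logicOf-CCL T = Cl-Th-⊆

  logicOf-SC : μ⊆ μ → SC (logicOf μ)
  logicOf-SC sub T = Th-antitone (sub _ Mod-Definable)

  logicOf-PR : μdp μ → μ⊆ μ → μPR μ → PR (logicOf μ)
  logicOf-PR dp sub pr T T' φ c v m = c v v∈μ[T∪T']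
    where
    v∈μT : μ (Mod T) v
    v∈μT = Definable⇒Mod-Th-⊆ (dp _ Mod-Definable) v (Mod-antitone (λ _ → inj₁) v m)
    v∈μ[T∪T'] : μ (Mod (T ∪ᵀ T')) v
    v∈μ[T∪T'] = pr _ _ Mod-Definable Mod-Definable (Mod-antitone (λ _ → inj₁)) v
      (v∈μT , Mod-∪ (sub _ Mod-Definable v v∈μT) (Mod-antitone (λ _ → inj₂) v m))

  logicOf-CUM : μCUM μ → CUM (logicOf μ)
  logicOf-CUM cum T T' T⊆ClT' ClT'⊆CT = Th-cong (swap μT'≐μT)
    where
    μT'≐μT : μ (Mod T') ≐ᴹ μ (Mod T)
    μT'≐μT = cum _ _ Mod-Definable Mod-Definable
      (λ v m → Mod-antitone (λ φ t → ClT'⊆CT φ (⊆-Cl φ t)) v (⊆-Mod-Th v m))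
      (⊆-Cl⇒Mod-⊇ T⊆ClT')

  -- The goal is a Boolean equation, so the two double negations can be
  -- eliminated against it.
  logicOf-A-min : {n : ℕ} (α : Fin n → Form V) →
                  μdp μ → μA α μ → A-min α (logicOf μ)
  logicOf-A-min α dp minA T i j i<j ⊬¬αi ⊬¬αj v m =
    ⊭⇒⊨neg (α j) λ ⊨αj →
      ⊬neg⇒¬¬Meets-Mod {φ = α i} ⊬¬αi λ meetsᵢ →
      ⊬neg⇒¬¬Meets-Mod {φ = α j} ⊬¬αj λ meetsⱼ →
      minA _ Mod-Definable i j i<j meetsᵢ meetsⱼ v v∈μT ⊨αj
    where
    v∈μT : μ (Mod T) v
    v∈μT = Definable⇒Mod-Th-⊆ (dp _ Mod-Definable) v m

μOf : Logic V → ModelSet V → ModelSet V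
μOf C X = Mod (C (Th X))

module _ (C : Logic V) where

  logicOf-μOf : LLE C → CCL C → ∀ T → C T ≐ᵀ logicOf (μOf C) T
  logicOf-μOf lle ccl T =
    (λ φ c → ⊆-Cl φ (proj₁ CT≐C[ClT] φ c)) ,
    (λ φ c → proj₂ CT≐C[ClT] φ (ccl (Cl T) φ c))
    where
    CT≐C[ClT] : C T ≐ᵀ C (Cl T)
    CT≐C[ClT] = lle T (Cl T) (swap Cl-idempotent)

  μOf-dp : μdp (μOf C)
  μOf-dp X _ = Mod-Definable

  μOf-⊆ : SC C → μ⊆ (μOf C)
  μOf-⊆ sc X dX v m =
    Definable⇒Mod-Th-⊆ dX v (Mod-antitone (λ φ t → sc (Th X) φ (⊆-Cl φ t)) v m)

  μOf-PR : LLE C → PR C → μPR (μOf C)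
  μOf-PR lle pr X Y _ _ X⊆Y v (v∈μY , x) φ c =
    pr (Th Y) (Th X) φ (proj₂ C[ThY∪ThX]≐C[ThX] φ c) v
      (Mod-∪ v∈μY (⊆-Mod-Th v x))
    where
    C[ThY∪ThX]≐C[ThX] : C (Th Y ∪ᵀ Th X) ≐ᵀ C (Th X)
    C[ThY∪ThX]≐C[ThX] =
      lle _ _ (Cl-∪-absorbˡ (λ φ t → ⊆-Cl φ (Th-antitone X⊆Y φ t)))

  μOf-CUM : CCL C → CUM C → μCUM (μOf C)
  μOf-CUM ccl cum X Y _ _ μX⊆Y Y⊆X = Mod-cong (swap C[ThX]≐C[ThY])
    where
    C[ThX]≐C[ThY] : C (Th X) ≐ᵀ C (Th Y)
    C[ThX]≐C[ThY] = cum (Th X) (Th Y)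
      (λ φ t → ⊆-Cl φ (Th-antitone Y⊆X φ t))
      (λ φ c → ccl (Th X) φ (Cl-least (Th-antitone μX⊆Y) φ c))

  μOf-A : {n : ℕ} (α : Fin n → Form V) → A-min α C → μA α (μOf C)
  μOf-A α minA X _ i j i<j meetsᵢ meetsⱼ v m =
    ⊨neg⇒⊭ (α j) (minA (Th X) i j i<j
      (Meets⇒Th-⊬neg {φ = α i} meetsᵢ) (Meets⇒Th-⊬neg {φ = α j} meetsⱼ) v m)

proposition3p26 : (V : Set) (n : ℕ) (α : Fin n → Form V) → IsOrderedPartition α →
    ((μ : ModelSet V → ModelSet V) → μdp μ → μ⊆ μ → μPR μ →
        (LLE (logicOf μ) × CCL (logicOf μ) × SC (logicOf μ) × PR (logicOf μ))
        × (μCUM μ → CUM (logicOf μ))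
        × (μA α μ → A-min α (logicOf μ)))
    ×
    ((C : Logic V) → LLE C → CCL C → SC C → PR C →
        Σ (ModelSet V → ModelSet V) (λ μ →
          (∀ T → C T ≐ᵀ Th (μ (Mod T)))
          × μdp μ × μ⊆ μ × μPR μ
          × (CUM C → μCUM μ)
          × (A-min α C → μA α μ)))
proposition3p26 V n α _ =
  (λ μ dp sub pr →
    (logicOf-LLE μ sub pr , logicOf-CCL μ , logicOf-SC μ sub , logicOf-PR μ dp sub pr) ,
    logicOf-CUM μ , logicOf-A-min μ α dp) ,
  (λ C lle ccl sc pr →
    μOf C , logicOf-μOf C lle ccl , μOf-dp C , μOf-⊆ C sc , μOf-PR C lle pr ,
    μOf-CUM C ccl , μOf-A C α)
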